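{- Let $n \geq 1$ and $1 \leq k \leq n$ be integers. Call a set $A \subseteq \{0,1\}^n$ admissible if there are no two distinct $x, y \in A$ with $x_i \leq y_i$ for all $i$ and $x_i < y_i$ for at most $k$ coordinates $i$. Let $\mathcal{C}$ be the set of all chains in $\{0,1\}^n$ of length exactly $k+1$ together with all symmetric chains in $\{0,1\}^n$ of length less than $k+1$. Suppose there exist strictly positive real weights $w_\gamma$, $\gamma \in \mathcal{C}$, such that for every $x \in \{0,1\}^n$, \[ \sum_{\gamma \in \mathcal{C}:\ x \in \gamma} w_\gamma = 1. \] Then: if $n$ is even, the unique admissible set of largest cardinality is $B = \{x \in \{0,1\}^n : |x| \equiv \tfrac{n}{2} \pmod{k+1}\}$; if $n$ is odd, the only admissible sets of largest cardinality are $B_1 = \{x : |x| \equiv \lfloor \tfrac n2 \rfloor \pmod{k+1}\}$ and $B_2 = \{x : |x| \equiv \lceil \tfrac n2 \rceil \pmod{k+1}\}$.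
   Context: For $x \in \{0,1\}^n$, $|x| = \sum_i x_i$, and the layer $L_m = \{x : |x| = m\}$. For $x, y \in \{0,1\}^n$ write $x \prec y$ if there is a coordinate $j$ with $x_i = y_i$ for all $i \neq j$, $x_j = 0$, $y_j = 1$. A chain is an ordered tuple $(x_1, \dots, x_l)$ of elements of $\{0,1\}^n$ with $x_1 \prec x_2 \prec \dots \prec x_l$; its length is $l$ (a single element is a chain of length $1$). Such a chain with $x_1 \in L_m$ (so $x_l \in L_{m+l-1}$) is called symmetric if $m + (m+l-1) = n$. The notation $x \in \gamma$ means $x$ is one of the entries of the chain $\gamma$.
   Formalization: The strictly positive weights $w_\gamma$ are rational rather than real. -}

module Defs where

open import Data.Bool using (Bool; true; false; _∧_; _∨_; if_then_else_; T)
open import Data.Nat using (ℕ; zero; suc; _+_; _∸_; _≤_; _≡ᵇ_; _<ᵇ_; _%_; _/_)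
open import Data.List using (List; []; _∷_; _++_; length; map; concatMap; filterᵇ; applyUpTo)
open import Data.Vec using (Vec; []; _∷_)
open import Data.Rational using (ℚ; 0ℚ; 1ℚ) renaming (_+_ to _+ℚ_)
open import Data.Product using (_×_)
open import Data.Sum using (_⊎_)
open import Relation.Nullary using (¬_)
open import Relation.Binary.PropositionalEquality using (_≡_; _≢_)

_==_ : Bool → Bool → Bool
true  == true  = true
false == false = true
_     == _     = false

eqV : ∀ {n} → Vec Bool n → Vec Bool n → Bool
eqV [] [] = true
eqV (a ∷ xs) (b ∷ ys) = (a == b) ∧ eqV xs ys

allVecs : (n : ℕ) → List (Vec Bool n)
allVecs zero = [] ∷ []
allVecs (suc n) = map (false ∷_) (allVecs n) ++ map (true ∷_) (allVecs n)

wt : ∀ {n} → Vec Bool n → ℕ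
wt [] = 0
wt (true ∷ xs) = suc (wt xs)
wt (false ∷ xs) = wt xs

covers : ∀ {n} → Vec Bool n → Vec Bool n → Bool
covers [] [] = false
covers (false ∷ xs) (true ∷ ys) = eqV xs ys
covers (a ∷ xs) (b ∷ ys) = (a == b) ∧ covers xs ys

isChain : ∀ {n} → List (Vec Bool n) → Bool
isChain [] = false
isChain (x ∷ []) = true
isChain (x ∷ y ∷ γ) = covers x y ∧ isChain (y ∷ γ)

tuples : (n l : ℕ) → List (List (Vec Bool n))
tuples n zero = [] ∷ []
tuples n (suc l) = concatMap (λ x → map (x ∷_) (tuples n l)) (allVecs n)

-- symmetric: first entry in L_m, length l, m + (m + l - 1) = n
isSymmetric : ∀ {n} → List (Vec Bool n) → Bool
isSymmetric {n} [] = false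
isSymmetric {n} γ@(x ∷ _) = (wt x + (wt x + length γ ∸ 1)) ≡ᵇ n

inC : (n k : ℕ) → List (Vec Bool n) → Bool
inC n k γ = isChain γ ∧ ((length γ ≡ᵇ suc k) ∨ ((length γ <ᵇ suc k) ∧ isSymmetric γ))

-- the finite family 𝒞, listed without repetitions (lengths 1, ..., k+1)
chainsC : (n k : ℕ) → List (List (Vec Bool n))
chainsC n k = concatMap (λ l → filterᵇ (inC n k) (tuples n l)) (applyUpTo suc (suc k))

memᵇ : ∀ {n} → Vec Bool n → List (Vec Bool n) → Bool
memᵇ x [] = false
memᵇ x (y ∷ γ) = eqV x y ∨ memᵇ x γ

sumℚ : List ℚ → ℚ
sumℚ [] = 0ℚ
sumℚ (q ∷ qs) = q +ℚ sumℚ qs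

SubsetC : ℕ → Set
SubsetC n = Vec Bool n → Bool

card : ∀ {n} → SubsetC n → ℕ
card {n} A = length (filterᵇ A (allVecs n))

leqV : ∀ {n} → Vec Bool n → Vec Bool n → Bool
leqV [] [] = true
leqV (true ∷ xs) (false ∷ ys) = false
leqV (_ ∷ xs) (_ ∷ ys) = leqV xs ys

strictCount : ∀ {n} → Vec Bool n → Vec Bool n → ℕ
strictCount [] [] = 0
strictCount (false ∷ xs) (true ∷ ys) = suc (strictCount xs ys)
strictCount (_ ∷ xs) (_ ∷ ys) = strictCount xs ys

Admissible : (n k : ℕ) → SubsetC n → Set
Admissible n k A = ∀ x y → A x ≡ true → A y ≡ true → x ≢ y →
  ¬ (leqV x y ≡ true × strictCount x y ≤ k)

Bset : (n k r : ℕ) → SubsetC n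
Bset n k r x = (wt x % suc k) ≡ᵇ (r % suc k)

IsMaxAdmissible : (n k : ℕ) → SubsetC n → Set
IsMaxAdmissible n k B = Admissible n k B × (∀ A → Admissible n k A → card A ≤ card B)

_≐_ : ∀ {n} → SubsetC n → SubsetC n → Set
A ≐ B = ∀ x → A x ≡ B x

{-# OPTIONS --safe #-}
module Submission where

-- Weighting the chains of 𝒞 turns |A| into Σ_γ w_γ |A ∩ γ|, because the weights of the chains
-- through any point add up to 1. Two elements of one chain of 𝒞 are comparable and differ in at
-- most k coordinates, so an admissible A meets every chain at most once and |A| ≤ Σ_γ w_γ. For
-- r = ⌊n/2⌋ or ⌈n/2⌉ the residue class B_r attains this bound: it is admissible, a chain of length
-- k+1 runs through k+1 consecutive layers and a symmetric chain runs through layer r. Conversely,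
-- since all weights are positive, a maximum A meets every chain of 𝒞. Running a chain of length k+1
-- through a diamond z ≺ x, y ≺ u shows that x ∈ A forces y ∈ A, so A is a union of layers. Every
-- window of k+1 consecutive layers contains exactly one of them, so they form a residue class
-- modulo k+1, and the symmetric chains of length 1 or 2 in the middle of the cube force this class
-- to be B_⌊n/2⌋ or B_⌈n/2⌉.

open import Defs
open import Algebra.Bundles using (CommutativeMonoid)
open import Data.Bool using (Bool; true; false; T; T?; _∧_; if_then_else_)
open import Data.Bool.Properties using (T-≡; T-∧; T-∨)
open import Data.Empty using (⊥; ⊥-elim)
open import Data.List using (List; []; _∷_; length; map; filterᵇ; applyUpTo)
open import Data.List.Membership.Propositional using (_∈_; lose)
open import Data.List.Membership.Propositional.Properties
  using (∈-map⁺; ∈-map⁻; ∈-++⁺ˡ; ∈-++⁺ʳ; ∈-filter⁺; ∈-filter⁻; ∈-concatMap⁺; ∈-concatMap⁻;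
         ∈-applyUpTo⁺; ∈-length)
open import Data.List.Relation.Unary.Any using (here; there; satisfied)
open import Data.List.Relation.Unary.All using ([]; _∷_)
open import Data.List.Relation.Unary.AllPairs using ([]; _∷_)
open import Data.List.Relation.Unary.Unique.Propositional using (Unique)
import Data.List.Relation.Unary.Unique.Propositional.Properties as Unique
open import Data.Nat using (ℕ; zero; suc; _+_; _∸_; _*_; _≤_; _<_; z≤n; s≤s; _%_; _/_; _≡ᵇ_; _<ᵇ_; NonZero)
open import Data.Nat.Properties
open import Data.Nat.DivMod
open import Data.Nat.Divisibility using (divides; n∣m*n; ∣m+n∣m⇒∣n; ∣⇒≤)
open import Data.Product using (_×_; _,_; proj₁; proj₂; ∃-syntax; ∃₂)
open import Data.Rational as ℚ using (ℚ; 0ℚ; 1ℚ)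
import Data.Rational.Properties as ℚ
import Data.Sum as Sum
open import Data.Sum using (_⊎_; inj₁; inj₂)
open import Data.Unit using (tt)
open import Data.Vec using (Vec; []; _∷_)
open import Data.Vec.Properties using (∷-injectiveʳ)
open import Function using (_∘_; _⇔_; Equivalence; mk⇔)
open import Function.Construct.Composition using (_⇔-∘_)
open import Function.Construct.Identity using (⇔-id)
open import Function.Construct.Symmetry using (⇔-sym)
open import Relation.Binary.Definitions using (tri<; tri≈; tri>)
open import Relation.Binary.PropositionalEquality
open import Relation.Nullary using (yes; no)

open import Algebra.Properties.CommutativeSemigroup
  (CommutativeMonoid.commutativeSemigroup ℚ.+-0-commutativeMonoid) using (interchange)
open import Algebra.Properties.Monoid.Mult ℚ.+-0-monoid using () renaming (_×_ to _·_)

-- Lists and sums of rationals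

module _ {A : Set} where

  length≢0⇒∃∈ : {xs : List A} → length xs ≢ 0 → ∃[ x ] x ∈ xs
  length≢0⇒∃∈ {[]}    ne = ⊥-elim (ne refl)
  length≢0⇒∃∈ {x ∷ _} _  = x , here refl

  unique∧all-equal⇒length≤1 : {xs : List A} → Unique xs →
    (∀ {x y} → x ∈ xs → y ∈ xs → x ≡ y) → length xs ≤ 1
  unique∧all-equal⇒length≤1 {[]}        _               _  = z≤n
  unique∧all-equal⇒length≤1 {_ ∷ []}    _               _  = s≤s z≤n
  unique∧all-equal⇒length≤1 {_ ∷ _ ∷ _} ((x≢y ∷ _) ∷ _) eq =
    ⊥-elim (x≢y (eq (here refl) (there (here refl))))

  sumℚ-cong : (xs : List A) {f g : A → ℚ} → (∀ {x} → x ∈ xs → f x ≡ g x) →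
    sumℚ (map f xs) ≡ sumℚ (map g xs)
  sumℚ-cong []       _  = refl
  sumℚ-cong (x ∷ xs) eq = cong₂ ℚ._+_ (eq (here refl)) (sumℚ-cong xs (eq ∘ there))

  sumℚ-mono-≤ : (xs : List A) {f g : A → ℚ} → (∀ {x} → x ∈ xs → f x ℚ.≤ g x) →
    sumℚ (map f xs) ℚ.≤ sumℚ (map g xs)
  sumℚ-mono-≤ []       _  = ℚ.≤-refl
  sumℚ-mono-≤ (x ∷ xs) le = ℚ.+-mono-≤ (le (here refl)) (sumℚ-mono-≤ xs (le ∘ there))

  sumℚ-mono-< : (xs : List A) {f g : A → ℚ} → (∀ {x} → x ∈ xs → f x ℚ.≤ g x) →
    ∀ {y} → y ∈ xs → f y ℚ.< g y → sumℚ (map f xs) ℚ.< sumℚ (map g xs)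
  sumℚ-mono-< (x ∷ xs) le (here refl) lt = ℚ.+-mono-<-≤ lt (sumℚ-mono-≤ xs (le ∘ there))
  sumℚ-mono-< (x ∷ xs) le (there y∈) lt =
    ℚ.+-mono-≤-< (le (here refl)) (sumℚ-mono-< xs (le ∘ there) y∈ lt)

  sumℚ-zero : (xs : List A) → sumℚ (map (λ _ → 0ℚ) xs) ≡ 0ℚ
  sumℚ-zero []       = refl
  sumℚ-zero (x ∷ xs) = trans (ℚ.+-identityˡ _) (sumℚ-zero xs)

  sumℚ-const : (xs : List A) (q : ℚ) → sumℚ (map (λ _ → q) xs) ≡ length xs · q
  sumℚ-const []       q = refl
  sumℚ-const (x ∷ xs) q = cong (q ℚ.+_) (sumℚ-const xs q)

  sumℚ-+ : (xs : List A) (f g : A → ℚ) →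
    sumℚ (map f xs) ℚ.+ sumℚ (map g xs) ≡ sumℚ (map (λ x → f x ℚ.+ g x) xs)
  sumℚ-+ []       f g = ℚ.+-identityˡ 0ℚ
  sumℚ-+ (x ∷ xs) f g =
    trans (interchange (f x) _ (g x) _) (cong (f x ℚ.+ g x ℚ.+_) (sumℚ-+ xs f g))

  sumℚ-filterᵇ : (p : A → Bool) (f : A → ℚ) (xs : List A) →
    sumℚ (map f (filterᵇ p xs)) ≡ sumℚ (map (λ x → if p x then f x else 0ℚ) xs)
  sumℚ-filterᵇ p f []       = refl
  sumℚ-filterᵇ p f (x ∷ xs) with p x
  ... | true  = cong (f x ℚ.+_) (sumℚ-filterᵇ p f xs)
  ... | false = trans (sumℚ-filterᵇ p f xs) (sym (ℚ.+-identityˡ _))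

  sumℚ-indicator : (p : A → Bool) (q : ℚ) (xs : List A) →
    sumℚ (map (λ x → if p x then q else 0ℚ) xs) ≡ length (filterᵇ p xs) · q
  sumℚ-indicator p q xs = trans (sym (sumℚ-filterᵇ p (λ _ → q) xs)) (sumℚ-const (filterᵇ p xs) q)

sumℚ-comm : {A B : Set} (xs : List A) (ys : List B) (h : A → B → ℚ) →
  sumℚ (map (λ x → sumℚ (map (h x) ys)) xs) ≡ sumℚ (map (λ y → sumℚ (map (λ x → h x y) xs)) ys)
sumℚ-comm []       ys h = sym (sumℚ-zero ys)
sumℚ-comm (x ∷ xs) ys h =
  trans (cong (sumℚ (map (h x) ys) ℚ.+_) (sumℚ-comm xs ys h)) (sumℚ-+ ys (h x) _)

fromℕ : ℕ → ℚ
fromℕ m = m · 1ℚ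

fromℕ-<-suc : ∀ m → fromℕ m ℚ.< fromℕ (suc m)
fromℕ-<-suc m =
  subst (ℚ._< fromℕ (suc m)) (ℚ.+-identityˡ (fromℕ m)) (ℚ.+-monoˡ-< (fromℕ m) (ℚ.positive⁻¹ 1ℚ))

fromℕ-mono-≤ : ∀ {m n} → m ≤ n → fromℕ m ℚ.≤ fromℕ n
fromℕ-mono-≤ {n = zero}  z≤n       = ℚ.≤-refl
fromℕ-mono-≤ {n = suc n} z≤n       = ℚ.≤-trans (fromℕ-mono-≤ {n = n} z≤n) (ℚ.<⇒≤ (fromℕ-<-suc n))
fromℕ-mono-≤             (s≤s m≤n) = ℚ.+-monoʳ-≤ 1ℚ (fromℕ-mono-≤ m≤n)

fromℕ-mono-< : ∀ {m n} → m < n → fromℕ m ℚ.< fromℕ n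
fromℕ-mono-< {m} m<n = ℚ.<-≤-trans (fromℕ-<-suc m) (fromℕ-mono-≤ m<n)

fromℕ-cancel-≤ : ∀ {m n} → fromℕ m ℚ.≤ fromℕ n → m ≤ n
fromℕ-cancel-≤ {m} {n} le with m ≤? n
... | yes m≤n = m≤n
... | no  m≰n = ⊥-elim (ℚ.<-irrefl refl (ℚ.<-≤-trans (fromℕ-mono-< (≰⇒> m≰n)) le))

c≤1⇒c·q≤q : ∀ {c q} → c ≤ 1 → 0ℚ ℚ.≤ q → c · q ℚ.≤ q
c≤1⇒c·q≤q {zero}        _        0≤q = 0≤q
c≤1⇒c·q≤q {suc zero} {q} _       _   = ℚ.≤-reflexive (ℚ.+-identityʳ q)
c≤1⇒c·q≤q {suc (suc _)} (s≤s ()) _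

module DoubleCounting {X Y : Set} (points : List X) (blocks : List Y) (_∈ᵇ_ : X → Y → Bool)
  (w : Y → ℚ) (w-pos : ∀ {γ} → γ ∈ blocks → 0ℚ ℚ.< w γ)
  (w-partition : ∀ x → sumℚ (map w (filterᵇ (x ∈ᵇ_) blocks)) ≡ 1ℚ) where

  size : (X → Bool) → ℕ
  size A = length (filterᵇ A points)

  _∩ᵇ_ : (X → Bool) → Y → X → Bool
  (A ∩ᵇ γ) x = A x ∧ x ∈ᵇ γ

  hits : (X → Bool) → Y → ℕ
  hits A γ = size (A ∩ᵇ γ)

  total : ℚ
  total = sumℚ (map w blocks)

  size≡weighted-hits : ∀ A → fromℕ (size A) ≡ sumℚ (map (λ γ → hits A γ · w γ) blocks)
  size≡weighted-hits A = begin
    fromℕ (size A)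
      ≡⟨ sumℚ-indicator A 1ℚ points ⟨
    sumℚ (map (λ x → if A x then 1ℚ else 0ℚ) points)
      ≡⟨ sumℚ-cong points (λ {x} _ → spread x) ⟩
    sumℚ (map (λ x → sumℚ (map (λ γ → if A x ∧ x ∈ᵇ γ then w γ else 0ℚ) blocks)) points)
      ≡⟨ sumℚ-comm points blocks _ ⟩
    sumℚ (map (λ γ → sumℚ (map (λ x → if A x ∧ x ∈ᵇ γ then w γ else 0ℚ) points)) blocks)
      ≡⟨ sumℚ-cong blocks (λ {γ} _ → sumℚ-indicator _ (w γ) points) ⟩
    sumℚ (map (λ γ → hits A γ · w γ) blocks) ∎
    where
      open ≡-Reasoning
      spread : ∀ x → (if A x then 1ℚ else 0ℚ) ≡
                     sumℚ (map (λ γ → if A x ∧ x ∈ᵇ γ then w γ else 0ℚ) blocks)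
      spread x with A x
      ... | true  = trans (sym (w-partition x)) (sumℚ-filterᵇ (x ∈ᵇ_) w blocks)
      ... | false = sym (sumℚ-zero blocks)

  module _ {A : X → Bool} (at-most-once : ∀ {γ} → γ ∈ blocks → hits A γ ≤ 1) where

    size≤total : fromℕ (size A) ℚ.≤ total
    size≤total = subst (ℚ._≤ total) (sym (size≡weighted-hits A))
      (sumℚ-mono-≤ blocks (λ γ∈ → c≤1⇒c·q≤q (at-most-once γ∈) (ℚ.<⇒≤ (w-pos γ∈))))

    size<total : ∀ {γ} → γ ∈ blocks → hits A γ ≡ 0 → fromℕ (size A) ℚ.< total
    size<total γ∈ hits≡0 = subst (ℚ._< total) (sym (size≡weighted-hits A))
      (sumℚ-mono-< blocks (λ γ∈ → c≤1⇒c·q≤q (at-most-once γ∈) (ℚ.<⇒≤ (w-pos γ∈))) γ∈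
        (subst (λ c → c · _ ℚ.< _) (sym hits≡0) (w-pos γ∈)))

  size≡total : ∀ {A} → (∀ {γ} → γ ∈ blocks → hits A γ ≡ 1) → fromℕ (size A) ≡ total
  size≡total {A} hits≡1 = trans (size≡weighted-hits A)
    (sumℚ-cong blocks (λ {γ} γ∈ → trans (cong (_· w γ) (hits≡1 γ∈)) (ℚ.+-identityʳ (w γ))))

  ∈-hits⁻ : ∀ {A γ x} → x ∈ filterᵇ (A ∩ᵇ γ) points → T (x ∈ᵇ γ) × A x ≡ true
  ∈-hits⁻ {A} {γ} {x} x∈ =
    let (Ax , x∈γ) = Equivalence.to (T-∧ {A x}) (proj₂ (∈-filter⁻ (T? ∘ (A ∩ᵇ γ)) {xs = points} x∈))
    in x∈γ , Equivalence.to T-≡ Ax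

  hits≤1 : ∀ {A γ} → Unique points →
    (∀ {x y} → T (x ∈ᵇ γ) → A x ≡ true → T (y ∈ᵇ γ) → A y ≡ true → x ≡ y) → hits A γ ≤ 1
  hits≤1 {A} {γ} unique once =
    unique∧all-equal⇒length≤1 (Unique.filter⁺ (T? ∘ (A ∩ᵇ γ)) unique) λ x∈ y∈ →
      let (x∈γ , Ax) = ∈-hits⁻ {A} {γ} x∈; (y∈γ , Ay) = ∈-hits⁻ {A} {γ} y∈ in once x∈γ Ax y∈γ Ay

  hits≥1 : ∀ {A γ x} → x ∈ points → T (x ∈ᵇ γ) → A x ≡ true → 1 ≤ hits A γ
  hits≥1 {A} {γ} x∈ x∈γ Ax =
    ∈-length (∈-filter⁺ (T? ∘ (A ∩ᵇ γ)) x∈ (Equivalence.from T-∧ (Equivalence.from T-≡ Ax , x∈γ)))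

  hits≢0⇒∃ : ∀ {A γ} → hits A γ ≢ 0 → ∃[ x ] T (x ∈ᵇ γ) × A x ≡ true
  hits≢0⇒∃ {A} {γ} ne = let (x , x∈) = length≢0⇒∃∈ ne in x , ∈-hits⁻ {A} {γ} x∈

-- The cube {0,1}ⁿ

infix 4 _≺_ _⊑_ _∈ᶜ_

_≺_ : ∀ {m} → Vec Bool m → Vec Bool m → Set
x ≺ y = T (covers x y)

_⊑_ : ∀ {m} → Vec Bool m → Vec Bool m → Set
x ⊑ y = T (leqV x y)

_∈ᶜ_ : ∀ {m} → Vec Bool m → List (Vec Bool m) → Set
x ∈ᶜ γ = T (memᵇ x γ)

Chain : ∀ {m} → List (Vec Bool m) → Set
Chain γ = T (isChain γ)

eqV-refl : ∀ {m} (x : Vec Bool m) → T (eqV x x)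
eqV-refl []          = tt
eqV-refl (true  ∷ x) = eqV-refl x
eqV-refl (false ∷ x) = eqV-refl x

eqV⇒≡ : ∀ {m} (x y : Vec Bool m) → T (eqV x y) → x ≡ y
eqV⇒≡ []          []          _ = refl
eqV⇒≡ (true  ∷ x) (true  ∷ y) e = cong (true ∷_) (eqV⇒≡ x y e)
eqV⇒≡ (false ∷ x) (false ∷ y) e = cong (false ∷_) (eqV⇒≡ x y e)
eqV⇒≡ (true  ∷ x) (false ∷ y) ()
eqV⇒≡ (false ∷ x) (true  ∷ y) ()

⊑-refl : ∀ {m} (x : Vec Bool m) → x ⊑ x
⊑-refl []          = tt
⊑-refl (true  ∷ x) = ⊑-refl x
⊑-refl (false ∷ x) = ⊑-refl x

⊑-trans : ∀ {m} (x y z : Vec Bool m) → x ⊑ y → y ⊑ z → x ⊑ z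
⊑-trans []          []          []          _ _ = tt
⊑-trans (true  ∷ x) (true  ∷ y) (true  ∷ z) p q = ⊑-trans x y z p q
⊑-trans (false ∷ x) (true  ∷ y) (true  ∷ z) p q = ⊑-trans x y z p q
⊑-trans (false ∷ x) (false ∷ y) (true  ∷ z) p q = ⊑-trans x y z p q
⊑-trans (false ∷ x) (false ∷ y) (false ∷ z) p q = ⊑-trans x y z p q
⊑-trans (true  ∷ x) (false ∷ y) _           () _
⊑-trans (_     ∷ x) (true  ∷ y) (false ∷ z) _ ()

wt≡wt+strictCount : ∀ {m} (x y : Vec Bool m) → x ⊑ y → wt y ≡ wt x + strictCount x y
wt≡wt+strictCount []          []          _ = refl
wt≡wt+strictCount (true  ∷ x) (true  ∷ y) p = cong suc (wt≡wt+strictCount x y p)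
wt≡wt+strictCount (false ∷ x) (true  ∷ y) p =
  trans (cong suc (wt≡wt+strictCount x y p)) (sym (+-suc (wt x) _))
wt≡wt+strictCount (false ∷ x) (false ∷ y) p = wt≡wt+strictCount x y p
wt≡wt+strictCount (true  ∷ x) (false ∷ y) ()

⊑⇒wt≤ : ∀ {m} (x y : Vec Bool m) → x ⊑ y → wt x ≤ wt y
⊑⇒wt≤ x y x⊑y = subst (wt x ≤_) (sym (wt≡wt+strictCount x y x⊑y)) (m≤m+n (wt x) _)

⊑∧strictCount≡0⇒≡ : ∀ {m} (x y : Vec Bool m) → x ⊑ y → strictCount x y ≡ 0 → x ≡ y
⊑∧strictCount≡0⇒≡ []          []          _ _ = refl
⊑∧strictCount≡0⇒≡ (true  ∷ x) (true  ∷ y) p e = cong (true ∷_) (⊑∧strictCount≡0⇒≡ x y p e)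
⊑∧strictCount≡0⇒≡ (false ∷ x) (false ∷ y) p e = cong (false ∷_) (⊑∧strictCount≡0⇒≡ x y p e)
⊑∧strictCount≡0⇒≡ (true  ∷ x) (false ∷ y) () _
⊑∧strictCount≡0⇒≡ (false ∷ x) (true  ∷ y) _ ()

⊑∧wt≡⇒≡ : ∀ {m} (x y : Vec Bool m) → x ⊑ y → wt x ≡ wt y → x ≡ y
⊑∧wt≡⇒≡ x y x⊑y e = ⊑∧strictCount≡0⇒≡ x y x⊑y
  (+-cancelˡ-≡ (wt x) _ _ (trans (sym (wt≡wt+strictCount x y x⊑y)) (trans (sym e) (sym (+-identityʳ (wt x))))))

≺⇒⊑ : ∀ {m} (x y : Vec Bool m) → x ≺ y → x ⊑ y
≺⇒⊑ []          []          ()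
≺⇒⊑ (true  ∷ x) (true  ∷ y) p = ≺⇒⊑ x y p
≺⇒⊑ (false ∷ x) (true  ∷ y) p = subst (x ⊑_) (eqV⇒≡ x y p) (⊑-refl x)
≺⇒⊑ (false ∷ x) (false ∷ y) p = ≺⇒⊑ x y p
≺⇒⊑ (true  ∷ x) (false ∷ y) ()

≺⇒wt≡suc : ∀ {m} (x y : Vec Bool m) → x ≺ y → wt y ≡ suc (wt x)
≺⇒wt≡suc []          []          ()
≺⇒wt≡suc (true  ∷ x) (true  ∷ y) p = cong suc (≺⇒wt≡suc x y p)
≺⇒wt≡suc (false ∷ x) (true  ∷ y) p = cong (suc ∘ wt) (sym (eqV⇒≡ x y p))
≺⇒wt≡suc (false ∷ x) (false ∷ y) p = ≺⇒wt≡suc x y p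
≺⇒wt≡suc (true  ∷ x) (false ∷ y) ()

wt≤dim : ∀ {m} (x : Vec Bool m) → wt x ≤ m
wt≤dim []          = z≤n
wt≤dim (true  ∷ x) = s≤s (wt≤dim x)
wt≤dim (false ∷ x) = m≤n⇒m≤1+n (wt≤dim x)

lowerOne : ∀ {m} → Vec Bool m → Vec Bool m
lowerOne []          = []
lowerOne (true  ∷ v) = false ∷ v
lowerOne (false ∷ v) = false ∷ lowerOne v

lowerOne-≺ : ∀ {m} (v : Vec Bool m) → 0 < wt v → lowerOne v ≺ v
lowerOne-≺ (true  ∷ v) _ = eqV-refl v
lowerOne-≺ (false ∷ v) p = lowerOne-≺ v p

lowerOne-⊑ : ∀ {m} (v : Vec Bool m) → lowerOne v ⊑ v
lowerOne-⊑ []          = tt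
lowerOne-⊑ (true  ∷ v) = ⊑-refl v
lowerOne-⊑ (false ∷ v) = lowerOne-⊑ v

wt≤wt-lowerOne+1 : ∀ {m} (v : Vec Bool m) → wt v ≤ suc (wt (lowerOne v))
wt≤wt-lowerOne+1 []          = z≤n
wt≤wt-lowerOne+1 (true  ∷ v) = ≤-refl
wt≤wt-lowerOne+1 (false ∷ v) = wt≤wt-lowerOne+1 v

raiseOne : ∀ {m} → Vec Bool m → Vec Bool m
raiseOne []          = []
raiseOne (false ∷ v) = true ∷ v
raiseOne (true  ∷ v) = true ∷ raiseOne v

≺-raiseOne : ∀ {m} (v : Vec Bool m) → wt v < m → v ≺ raiseOne v
≺-raiseOne (false ∷ v) _       = eqV-refl v
≺-raiseOne (true  ∷ v) (s≤s p) = ≺-raiseOne v p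

⊑-raiseOne : ∀ {m} (v : Vec Bool m) → v ⊑ raiseOne v
⊑-raiseOne []          = tt
⊑-raiseOne (false ∷ v) = ⊑-refl v
⊑-raiseOne (true  ∷ v) = ⊑-raiseOne v

wt-raiseOne≤wt+1 : ∀ {m} (v : Vec Bool m) → wt (raiseOne v) ≤ suc (wt v)
wt-raiseOne≤wt+1 []          = z≤n
wt-raiseOne≤wt+1 (false ∷ v) = ≤-refl
wt-raiseOne≤wt+1 (true  ∷ v) = s≤s (wt-raiseOne≤wt+1 v)

canonical : (m t : ℕ) → Vec Bool m
canonical zero    _       = []
canonical (suc m) zero    = false ∷ canonical m zero
canonical (suc m) (suc t) = true ∷ canonical m t

wt-canonical : ∀ {m t} → t ≤ m → wt (canonical m t) ≡ t
wt-canonical {zero}  z≤n     = refl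
wt-canonical {suc m} z≤n     = wt-canonical {m} z≤n
wt-canonical         (s≤s p) = cong suc (wt-canonical p)

canonical-⊑ : ∀ m {t t′} → t ≤ t′ → canonical m t ⊑ canonical m t′
canonical-⊑ zero    _                     = tt
canonical-⊑ (suc m) {zero} {zero}   _       = canonical-⊑ m z≤n
canonical-⊑ (suc m) {zero} {suc t′} _       = canonical-⊑ m z≤n
canonical-⊑ (suc m)                 (s≤s p) = canonical-⊑ m p

canonical-≺ : ∀ {m t} → t < m → canonical m t ≺ canonical m (suc t)
canonical-≺ {suc m} {zero}  _       = eqV-refl (canonical m zero)
canonical-≺ {suc m} {suc t} (s≤s p) = canonical-≺ p

-- Chains

∈ᶜ-∷⁻ : ∀ {m} (x y : Vec Bool m) γ → x ∈ᶜ (y ∷ γ) → x ≡ y ⊎ x ∈ᶜ γ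
∈ᶜ-∷⁻ x y γ p = Sum.map₁ (eqV⇒≡ x y) (Equivalence.to (T-∨ {eqV x y} {memᵇ x γ}) p)

∈ᶜ-here : ∀ {m} (x : Vec Bool m) γ → x ∈ᶜ (x ∷ γ)
∈ᶜ-here x γ = Equivalence.from (T-∨ {eqV x x} {memᵇ x γ}) (inj₁ (eqV-refl x))

∈ᶜ-there : ∀ {m} (x y : Vec Bool m) γ → x ∈ᶜ γ → x ∈ᶜ (y ∷ γ)
∈ᶜ-there x y γ p = Equivalence.from (T-∨ {eqV x y} {memᵇ x γ}) (inj₂ p)

chain-∷ : ∀ {m} (x y : Vec Bool m) γ → x ≺ y → Chain (y ∷ γ) → Chain (x ∷ y ∷ γ)
chain-∷ x y γ p q = Equivalence.from (T-∧ {covers x y} {isChain (y ∷ γ)}) (p , q)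

chain-∷⁻ : ∀ {m} (x y : Vec Bool m) γ → Chain (x ∷ y ∷ γ) → x ≺ y × Chain (y ∷ γ)
chain-∷⁻ x y γ = Equivalence.to (T-∧ {covers x y} {isChain (y ∷ γ)})

chain-bounds : ∀ {m} (a : Vec Bool m) γ v → Chain (a ∷ γ) → v ∈ᶜ (a ∷ γ) →
  a ⊑ v × wt v ≤ wt a + length γ
chain-bounds a γ v ch v∈ with ∈ᶜ-∷⁻ v a γ v∈
... | inj₁ refl = ⊑-refl a , m≤m+n (wt a) _
chain-bounds a []      v ch v∈ | inj₂ ()
chain-bounds a (b ∷ γ) v ch v∈ | inj₂ v∈γ
  with a≺b , ch′ ← chain-∷⁻ a b γ ch
  with b⊑v , wv  ← chain-bounds b γ v ch′ v∈γ =
  ⊑-trans a b v (≺⇒⊑ a b a≺b) b⊑v ,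
  ≤-trans wv (≤-reflexive (trans (cong (_+ length γ) (≺⇒wt≡suc a b a≺b)) (sym (+-suc (wt a) (length γ)))))

chain-hits-weight : ∀ {m} (a : Vec Bool m) γ {t} → Chain (a ∷ γ) → wt a ≤ t → t ≤ wt a + length γ →
  ∃[ x ] x ∈ᶜ (a ∷ γ) × wt x ≡ t
chain-hits-weight a γ ch a≤t t≤ with m≤n⇒m<n∨m≡n a≤t
... | inj₂ refl = a , ∈ᶜ-here a γ , refl
chain-hits-weight a []      {t} ch a≤t t≤ | inj₁ a<t =
  ⊥-elim (<⇒≱ a<t (subst (t ≤_) (+-identityʳ (wt a)) t≤))
chain-hits-weight a (b ∷ γ) {t} ch a≤t t≤ | inj₁ a<t
  with a≺b , ch′ ← chain-∷⁻ a b γ ch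
  with wb ← ≺⇒wt≡suc a b a≺b
  with x , x∈ , wx ← chain-hits-weight b γ ch′ (subst (_≤ _) (sym wb) a<t)
                       (subst (t ≤_) (trans (+-suc (wt a) (length γ)) (cong (_+ length γ) (sym wb))) t≤)
  = x , ∈ᶜ-there x a (b ∷ γ) x∈ , wx

admissible-far : ∀ {n k A} (x y : Vec Bool n) → Admissible n k A → A x ≡ true → A y ≡ true →
  x ⊑ y → wt x < wt y → wt x + k < wt y
admissible-far {k = k} x y adm Ax Ay x⊑y x<y = ≰⇒> λ y≤x+k →
  adm x y Ax Ay (λ x≡y → <-irrefl (cong wt x≡y) x<y)
    (Equivalence.to T-≡ x⊑y ,
     +-cancelˡ-≤ (wt x) _ _ (subst (_≤ wt x + k) (wt≡wt+strictCount x y x⊑y) y≤x+k))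

admissible-⊑⇒≡ : ∀ {n k A} (x y : Vec Bool n) → Admissible n k A → A x ≡ true → A y ≡ true →
  x ⊑ y → wt y ≤ wt x + k → x ≡ y
admissible-⊑⇒≡ x y adm Ax Ay x⊑y y≤x+k with m≤n⇒m<n∨m≡n (⊑⇒wt≤ x y x⊑y)
... | inj₁ x<y = ⊥-elim (<⇒≱ (admissible-far x y adm Ax Ay x⊑y x<y) y≤x+k)
... | inj₂ x≡y = ⊑∧wt≡⇒≡ x y x⊑y x≡y

admissible-chain-head : ∀ {n k A} (a : Vec Bool n) γ v → Admissible n k A → Chain (a ∷ γ) →
  length γ ≤ k → A a ≡ true → v ∈ᶜ (a ∷ γ) → A v ≡ true → a ≡ v
admissible-chain-head a γ v adm ch len Aa v∈ Av with a⊑v , wv ← chain-bounds a γ v ch v∈ =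
  admissible-⊑⇒≡ a v adm Aa Av a⊑v (≤-trans wv (+-monoʳ-≤ (wt a) len))

admissible-chain-≡ : ∀ {n k A} γ (x y : Vec Bool n) → Admissible n k A → Chain γ → length γ ≤ suc k →
  x ∈ᶜ γ → A x ≡ true → y ∈ᶜ γ → A y ≡ true → x ≡ y
admissible-chain-≡ (a ∷ γ) x y adm ch (s≤s len) x∈ Ax y∈ Ay
  with ∈ᶜ-∷⁻ x a γ x∈ | ∈ᶜ-∷⁻ y a γ y∈
... | inj₁ refl | _         = admissible-chain-head a γ y adm ch len Ax y∈ Ay
... | inj₂ _    | inj₁ refl = sym (admissible-chain-head a γ x adm ch len Ay x∈ Ax)
admissible-chain-≡ (a ∷ [])    x y adm ch len x∈ Ax y∈ Ay | inj₂ () | inj₂ _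
admissible-chain-≡ (a ∷ b ∷ γ) x y adm ch (s≤s len) x∈ Ax y∈ Ay | inj₂ x∈γ | inj₂ y∈γ =
  admissible-chain-≡ (b ∷ γ) x y adm (proj₂ (chain-∷⁻ a b γ ch)) (m≤n⇒m≤1+n len) x∈γ Ax y∈γ Ay

upFrom : ∀ {m} → Vec Bool m → ℕ → List (Vec Bool m)
upFrom u zero    = []
upFrom u (suc b) = u ∷ upFrom (raiseOne u) b

length-upFrom : ∀ {m} (u : Vec Bool m) b → length (upFrom u b) ≡ b
length-upFrom u zero    = refl
length-upFrom u (suc b) = cong suc (length-upFrom (raiseOne u) b)

upFrom-chain : ∀ {m} (u : Vec Bool m) b → wt u + b ≤ m → Chain (upFrom u (suc b))
upFrom-chain u zero    _ = tt
upFrom-chain {m} u (suc b) le =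
  chain-∷ u (raiseOne u) (upFrom (raiseOne (raiseOne u)) b) u≺ru (upFrom-chain (raiseOne u) b le′)
  where
    u≺ru : u ≺ raiseOne u
    u≺ru = ≺-raiseOne u (<-≤-trans (m<m+n (wt u) (s≤s z≤n)) le)
    le′ : wt (raiseOne u) + b ≤ m
    le′ = subst (λ w → w + b ≤ m) (sym (≺⇒wt≡suc u (raiseOne u) u≺ru)) (subst (_≤ m) (+-suc (wt u) b) le)

∷-upFrom-chain : ∀ {m} (y u : Vec Bool m) b → y ≺ u → wt y + b ≤ m → Chain (y ∷ upFrom u b)
∷-upFrom-chain y u zero    _   _  = tt
∷-upFrom-chain {m} y u (suc b) y≺u le = chain-∷ y u (upFrom (raiseOne u) b) y≺u
  (upFrom-chain u b (subst (λ w → w + b ≤ m) (sym (≺⇒wt≡suc y u y≺u)) (subst (_≤ m) (+-suc (wt y) b) le)))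

∈-upFrom : ∀ {m} (u : Vec Bool m) b v → v ∈ᶜ upFrom u b → u ⊑ v × wt v < wt u + b
∈-upFrom u (suc b) v v∈ with ∈ᶜ-∷⁻ v u (upFrom (raiseOne u) b) v∈
... | inj₁ refl = ⊑-refl u , subst (wt u <_) (sym (+-suc (wt u) b)) (s≤s (m≤m+n (wt u) b))
... | inj₂ v∈′ with ru⊑v , lt ← ∈-upFrom (raiseOne u) b v v∈′ =
  ⊑-trans u (raiseOne u) v (⊑-raiseOne u) ru⊑v ,
  <-≤-trans lt (≤-trans (+-monoˡ-≤ b (wt-raiseOne≤wt+1 u)) (≤-reflexive (sym (+-suc (wt u) b))))

-- downTo z a γ = lowerOne^(a-1) z ∷ ⋯ ∷ lowerOne z ∷ z ∷ γ
downTo : ∀ {m} → Vec Bool m → ℕ → List (Vec Bool m) → List (Vec Bool m)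
downTo z zero    γ = γ
downTo z (suc a) γ = downTo (lowerOne z) a (z ∷ γ)

length-downTo : ∀ {m} (z : Vec Bool m) a γ → length (downTo z a γ) ≡ a + length γ
length-downTo z zero    γ = refl
length-downTo z (suc a) γ = trans (length-downTo (lowerOne z) a (z ∷ γ)) (+-suc a (length γ))

downTo-chain : ∀ {m} (z y : Vec Bool m) a γ → z ≺ y → Chain (y ∷ γ) → a ≤ suc (wt z) →
  Chain (downTo z a (y ∷ γ))
downTo-chain z y zero          γ _   ch _ = ch
downTo-chain z y (suc zero)    γ z≺y ch _ = chain-∷ z y γ z≺y ch
downTo-chain z y (suc (suc a)) γ z≺y ch (s≤s a<z) =
  downTo-chain (lowerOne z) z (suc a) (y ∷ γ) (lowerOne-≺ z (≤-trans (s≤s z≤n) a<z))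
    (chain-∷ z y γ z≺y ch) (≤-trans a<z (wt≤wt-lowerOne+1 z))

length-downTo-upFrom : ∀ {m} (z y u : Vec Bool m) a b → length (downTo z a (y ∷ upFrom u b)) ≡ suc (a + b)
length-downTo-upFrom z y u a b =
  trans (length-downTo z a (y ∷ upFrom u b)) (trans (cong (λ l → a + suc l) (length-upFrom u b)) (+-suc a b))

∈-downTo : ∀ {m} (z : Vec Bool m) a γ v → v ∈ᶜ downTo z a γ → v ∈ᶜ γ ⊎ (v ⊑ z × wt z < wt v + a)
∈-downTo z zero    γ v v∈ = inj₁ v∈
∈-downTo z (suc a) γ v v∈ with ∈-downTo (lowerOne z) a (z ∷ γ) v v∈
... | inj₂ (v⊑lz , lt) =
  inj₂ (⊑-trans v (lowerOne z) z v⊑lz (lowerOne-⊑ z) ,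
        ≤-trans (s≤s (wt≤wt-lowerOne+1 z)) (≤-trans (s≤s lt) (≤-reflexive (sym (+-suc (wt v) a)))))
... | inj₁ v∈′ with ∈ᶜ-∷⁻ v z γ v∈′
...   | inj₁ refl = inj₂ (⊑-refl v , subst (wt v <_) (sym (+-suc (wt v) a)) (s≤s (m≤m+n (wt v) a)))
...   | inj₂ v∈γ  = inj₁ v∈γ

Diamond : ∀ {m} → Vec Bool m → Vec Bool m → Set
Diamond x y = ∃₂ λ z u → z ≺ x × z ≺ y × x ≺ u × y ≺ u

diamond-sym : ∀ {m} {x y : Vec Bool m} → Diamond x y → Diamond y x
diamond-sym (z , u , z≺x , z≺y , x≺u , y≺u) = z , u , z≺y , z≺x , y≺u , x≺u

diamond-∷ : ∀ {m} c {x y : Vec Bool m} → Diamond x y → Diamond (c ∷ x) (c ∷ y)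
diamond-∷ true  (z , u , d) = true  ∷ z , true  ∷ u , d
diamond-∷ false (z , u , d) = false ∷ z , false ∷ u , d

diamond-swap : ∀ {m} (v : Vec Bool m) → 0 < wt v → Diamond (true ∷ lowerOne v) (false ∷ v)
diamond-swap v 0<v =
  false ∷ lowerOne v , true ∷ v , eqV-refl (lowerOne v) , lowerOne-≺ v 0<v , lowerOne-≺ v 0<v , eqV-refl v

-- Two vectors of equal weight are joined by diamonds, each moving a single 1 to another coordinate.
diamond-closed⇒weight-closed : ∀ {m} (P : Vec Bool m → Set) → (∀ {x y} → Diamond x y → P x → P y) →
  ∀ x y → wt x ≡ wt y → P x → P y
diamond-closed⇒weight-closed P closed []          []          _ = λ p → p
diamond-closed⇒weight-closed P closed (true  ∷ x) (true  ∷ y) e =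
  diamond-closed⇒weight-closed (P ∘ (true ∷_)) (closed ∘ diamond-∷ true) x y (suc-injective e)
diamond-closed⇒weight-closed P closed (false ∷ x) (false ∷ y) e =
  diamond-closed⇒weight-closed (P ∘ (false ∷_)) (closed ∘ diamond-∷ false) x y e
diamond-closed⇒weight-closed P closed (true  ∷ x) (false ∷ y) e =
  closed (diamond-swap y 0<y) ∘
  diamond-closed⇒weight-closed (P ∘ (true ∷_)) (closed ∘ diamond-∷ true) x (lowerOne y)
    (suc-injective (trans e (≺⇒wt≡suc (lowerOne y) y (lowerOne-≺ y 0<y))))
  where
    0<y : 0 < wt y
    0<y = subst (0 <_) e (s≤s z≤n)
diamond-closed⇒weight-closed P closed (false ∷ x) (true  ∷ y) e =
  diamond-closed⇒weight-closed (P ∘ (true ∷_)) (closed ∘ diamond-∷ true) (lowerOne x) y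
    (suc-injective (trans (sym (≺⇒wt≡suc (lowerOne x) x (lowerOne-≺ x 0<x))) e)) ∘
  closed (diamond-sym (diamond-swap x 0<x))
  where
    0<x : 0 < wt x
    0<x = subst (0 <_) (sym e) (s≤s z≤n)

-- The family 𝒞

∈-allVecs : ∀ {m} (x : Vec Bool m) → x ∈ allVecs m
∈-allVecs []                = here refl
∈-allVecs (false ∷ x)       = ∈-++⁺ˡ (∈-map⁺ (false ∷_) (∈-allVecs x))
∈-allVecs {suc m} (true ∷ x) = ∈-++⁺ʳ (map (false ∷_) (allVecs m)) (∈-map⁺ (true ∷_) (∈-allVecs x))

allVecs-unique : ∀ m → Unique (allVecs m)
allVecs-unique zero    = [] ∷ []
allVecs-unique (suc m) =
  Unique.++⁺ (Unique.map⁺ ∷-injectiveʳ (allVecs-unique m)) (Unique.map⁺ ∷-injectiveʳ (allVecs-unique m))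
             disjoint
  where
    disjoint : ∀ {v} → v ∈ map (false ∷_) (allVecs m) × v ∈ map (true ∷_) (allVecs m) → ⊥
    disjoint (v∈₀ , v∈₁) with ∈-map⁻ (false ∷_) v∈₀ | ∈-map⁻ (true ∷_) v∈₁
    ... | _ , _ , refl | _ , _ , ()

∈-tuples : ∀ {m} (γ : List (Vec Bool m)) → γ ∈ tuples m (length γ)
∈-tuples []      = here refl
∈-tuples (x ∷ γ) = ∈-concatMap⁺ _ (lose (∈-allVecs x) (∈-map⁺ (x ∷_) (∈-tuples γ)))

Symmetric : ∀ {m} → List (Vec Bool m) → Set
Symmetric γ = T (isSymmetric γ)

symmetric⇔ : ∀ {m} (a : Vec Bool m) γ → Symmetric (a ∷ γ) ⇔ wt a + (wt a + length γ) ≡ m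
symmetric⇔ a γ = mk⇔ (λ s → trans (cong (wt a +_) top) (≡ᵇ⇒≡ _ _ s))
                     (λ e → ≡⇒≡ᵇ _ _ (trans (cong (wt a +_) (sym top)) e))
  where
    top : wt a + length γ ≡ wt a + length (a ∷ γ) ∸ 1
    top = cong (_∸ 1) (sym (+-suc (wt a) (length γ)))

InC : (n k : ℕ) → List (Vec Bool n) → Set
InC n k γ = Chain γ × (length γ ≡ suc k ⊎ (length γ < suc k × Symmetric γ))

inC⇔InC : ∀ {n k} γ → T (inC n k γ) ⇔ InC n k γ
inC⇔InC {n} {k} γ = mk⇔
  (λ p → let (ch , len) = Equivalence.to (T-∧ {isChain γ}) p in
         ch , Sum.map (≡ᵇ⇒≡ _ _) short⁻ (Equivalence.to (T-∨ {length γ ≡ᵇ suc k}) len))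
  (λ (ch , len) → Equivalence.from (T-∧ {isChain γ})
         (ch , Equivalence.from (T-∨ {length γ ≡ᵇ suc k}) (Sum.map (≡⇒≡ᵇ _ _) short⁺ len)))
  where
    short⁻ : T ((length γ <ᵇ suc k) ∧ isSymmetric γ) → length γ < suc k × Symmetric γ
    short⁻ p = let (lt , s) = Equivalence.to (T-∧ {length γ <ᵇ suc k}) p in <ᵇ⇒< _ _ lt , s
    short⁺ : length γ < suc k × Symmetric γ → T ((length γ <ᵇ suc k) ∧ isSymmetric γ)
    short⁺ (lt , s) = Equivalence.from (T-∧ {length γ <ᵇ suc k}) (<⇒<ᵇ lt , s)

∈chainsC⁺ : ∀ {n k} γ → InC n k γ → γ ∈ chainsC n k
∈chainsC⁺ {n} {k} (x ∷ γ) inC@(_ , len) =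
  ∈-concatMap⁺ _ (lose (∈-applyUpTo⁺ suc (length<suc len))
    (∈-filter⁺ (T? ∘ Defs.inC n k) (∈-tuples (x ∷ γ)) (Equivalence.from (inC⇔InC (x ∷ γ)) inC)))
  where
    length<suc : length (x ∷ γ) ≡ suc k ⊎ (length (x ∷ γ) < suc k × Symmetric (x ∷ γ)) → length γ < suc k
    length<suc (inj₁ e)       = ≤-reflexive e
    length<suc (inj₂ (lt , _)) = ≤-trans (n≤1+n _) lt

∈chainsC⁻ : ∀ {n k} γ → γ ∈ chainsC n k → InC n k γ
∈chainsC⁻ {n} {k} γ γ∈ with l , γ∈ₗ ← satisfied (∈-concatMap⁻ _ {xs = applyUpTo suc (suc k)} γ∈) =
  Equivalence.to (inC⇔InC γ) (proj₂ (∈-filter⁻ (T? ∘ Defs.inC n k) {xs = tuples n l} γ∈ₗ))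

∈chainsC⇒chain : ∀ {n k} γ → γ ∈ chainsC n k → Chain γ × length γ ≤ suc k
∈chainsC⇒chain γ γ∈ with ch , len ← ∈chainsC⁻ γ γ∈ = ch , Sum.[ ≤-reflexive , <⇒≤ ∘ proj₁ ] len

chain⇒∈chainsC : ∀ {n k} γ → Chain γ → length γ ≡ suc k → γ ∈ chainsC n k
chain⇒∈chainsC γ ch len = ∈chainsC⁺ γ (ch , inj₁ len)

symmetric⇒∈chainsC : ∀ {n k} γ → Chain γ → length γ ≤ suc k → Symmetric γ → γ ∈ chainsC n k
symmetric⇒∈chainsC γ ch len s with m≤n⇒m<n∨m≡n len
... | inj₁ lt = ∈chainsC⁺ γ (ch , inj₂ (lt , s))
... | inj₂ e  = ∈chainsC⁺ γ (ch , inj₁ e)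

[m+1+d]%n≢m%n : ∀ m d {n} .{{_ : NonZero n}} → suc d < n → (m + suc d) % n ≢ m % n
[m+1+d]%n≢m%n m d {n} d<n eq =
  <⇒≱ d<n (∣⇒≤ (∣m+n∣m⇒∣n (divides ((m + suc d) / n) multiples) (n∣m*n (m / n))))
  where
    open ≡-Reasoning
    multiples : m / n * n + suc d ≡ (m + suc d) / n * n
    multiples = +-cancelˡ-≡ (m % n) _ _ (begin
      m % n + (m / n * n + suc d)   ≡⟨ +-assoc (m % n) _ _ ⟨
      m % n + m / n * n + suc d     ≡⟨ cong (_+ suc d) (m≡m%n+[m/n]*n m n) ⟨
      m + suc d                     ≡⟨ m≡m%n+[m/n]*n (m + suc d) n ⟩
      (m + suc d) % n + (m + suc d) / n * n ≡⟨ cong (_+ (m + suc d) / n * n) eq ⟩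
      m % n + (m + suc d) / n * n   ∎)

∃-window-≡-mod : ∀ m r d → ∃[ t ] m ≤ t × t ≤ m + d × t % suc d ≡ r % suc d
∃-window-≡-mod zero    r d = r % suc d , z≤n , ≤-pred (m%n<n r (suc d)) , m%n%n≡m%n r (suc d)
∃-window-≡-mod (suc m) r d with ∃-window-≡-mod m r d
... | t , m≤t , t≤m+d , t≡r with m≤n⇒m<n∨m≡n m≤t
...   | inj₁ m<t  = t , m<t , m≤n⇒m≤1+n t≤m+d , t≡r
...   | inj₂ refl = m + suc d , ≤-trans (s≤s (m≤m+n m d)) (≤-reflexive (sym (+-suc m d))) ,
                    ≤-reflexive (+-suc m d) , trans ([m+n]%n≡m%n m (suc d)) t≡r

split-≤ : ∀ {k t n} → k ≤ n → t ≤ n → ∃₂ λ a b → a + b ≡ k × a ≤ t × t + b ≤ n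
split-≤ {k} {t} {n} k≤n t≤n with k ≤? t
... | yes k≤t = k , 0 , +-identityʳ k , k≤t , subst (_≤ n) (sym (+-identityʳ t)) t≤n
... | no  k≰t = t , k ∸ t , m+[n∸m]≡n t≤k , ≤-refl , subst (_≤ n) (sym (m+[n∸m]≡n t≤k)) k≤n
  where
    t≤k : t ≤ k
    t≤k = <⇒≤ (≰⇒> k≰t)

-- r = ⌊n/2⌋ or r = ⌈n/2⌉
Central : ℕ → ℕ → Set
Central n r = n ≤ suc (r + r) × r + r ≤ suc n

central⇒between : ∀ {n r m l} → Central n r → m + (m + l) ≡ n → m ≤ r × r ≤ m + l
central⇒between {n} {r} {m} {l} (n≤2r+1 , 2r≤n+1) e = ≮⇒≥ r<m-impossible , ≮⇒≥ m+l<r-impossible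
  where
    double< : ∀ {a b} → a < b → suc (suc (a + a)) ≤ b + b
    double< {a} {b} a<b = subst (_≤ b + b) (cong suc (+-suc a a)) (+-mono-≤ a<b a<b)
    r<m-impossible : r < m → ⊥
    r<m-impossible r<m = <⇒≱ (double< r<m)
      (≤-trans (+-monoʳ-≤ m (m≤m+n m l)) (≤-trans (≤-reflexive e) n≤2r+1))
    m+l<r-impossible : m + l < r → ⊥
    m+l<r-impossible m+l<r = <⇒≱ (double< m+l<r)
      (≤-trans 2r≤n+1 (s≤s (≤-trans (≤-reflexive (sym e)) (+-monoˡ-≤ (m + l) (m≤m+n m l)))))

m*2≡m+m : ∀ m → m * 2 ≡ m + m
m*2≡m+m m = trans (*-comm m 2) (cong (m +_) (+-identityʳ m))

n≡n%2+[n/2+n/2] : ∀ n → n ≡ n % 2 + (n / 2 + n / 2)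
n≡n%2+[n/2+n/2] n = trans (m≡m%n+[m/n]*n n 2) (cong (n % 2 +_) (m*2≡m+m (n / 2)))

n%2≡0⇒n≡h+h : ∀ {n} → n % 2 ≡ 0 → n ≡ n / 2 + n / 2
n%2≡0⇒n≡h+h {n} e = trans (n≡n%2+[n/2+n/2] n) (cong (_+ (n / 2 + n / 2)) e)

n%2≡1⇒n≡1+h+h : ∀ {n} → n % 2 ≡ 1 → n ≡ suc (n / 2 + n / 2)
n%2≡1⇒n≡1+h+h {n} e = trans (n≡n%2+[n/2+n/2] n) (cong (_+ (n / 2 + n / 2)) e)

n≡1+h+h⇒[n+1]/2≡1+h : ∀ {n h} → n ≡ suc (h + h) → (n + 1) / 2 ≡ suc h
n≡1+h+h⇒[n+1]/2≡1+h {n} {h} e = trans (cong (_/ 2) n+1≡) (m*n/n≡m (suc h) 2)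
  where
    n+1≡ : n + 1 ≡ suc h * 2
    n+1≡ = trans (+-comm n 1) (cong suc (trans e (cong suc (sym (m*2≡m+m h)))))

central-⌊n/2⌋ : ∀ n → Central n (n / 2)
central-⌊n/2⌋ n = subst (_≤ suc (h + h)) (sym (n≡n%2+[n/2+n/2] n)) (+-monoˡ-≤ (h + h) (≤-pred (m%n<n n 2))) ,
                  m≤n⇒m≤1+n (subst (h + h ≤_) (sym (n≡n%2+[n/2+n/2] n)) (m≤n+m (h + h) (n % 2)))
  where
    h : ℕ
    h = n / 2

central-⌈n/2⌉ : ∀ {n h} → n ≡ suc (h + h) → Central n (suc h)
central-⌈n/2⌉ {n} {h} e =
  ≤-trans (n≤1+n n) (≤-trans (≤-reflexive (sym 2r≡n+1)) (n≤1+n _)) , ≤-reflexive 2r≡n+1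
  where
    2r≡n+1 : suc h + suc h ≡ suc n
    2r≡n+1 = cong suc (trans (+-suc h h) (sym e))

-- Maximum admissible sets

true⇔true⇒≡ : ∀ {a b : Bool} → a ≡ true ⇔ b ≡ true → a ≡ b
true⇔true⇒≡ {true}  {true}  _ = refl
true⇔true⇒≡ {false} {false} _ = refl
true⇔true⇒≡ {true}  {false} a⇔b = sym (Equivalence.to a⇔b refl)
true⇔true⇒≡ {false} {true}  a⇔b = Equivalence.from a⇔b refl

∈Bset⇔ : ∀ {n k} r (x : Vec Bool n) → Bset n k r x ≡ true ⇔ wt x % suc k ≡ r % suc k
∈Bset⇔ r x = mk⇔ (λ b → ≡ᵇ⇒≡ _ _ (Equivalence.from T-≡ b))
                  (λ e → Equivalence.to T-≡ (≡⇒≡ᵇ _ _ e))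

Bset-admissible : ∀ n k r → Admissible n k (Bset n k r)
Bset-admissible n k r x y Bx By x≢y (x⊑y , sc≤k) with strictCount x y in sc≡
... | zero  = x≢y (⊑∧strictCount≡0⇒≡ x y (Equivalence.from T-≡ x⊑y) sc≡)
... | suc d = [m+1+d]%n≢m%n (wt x) d (s≤s sc≤k) (begin
  (wt x + suc d) % suc k ≡⟨ cong (_% suc k) y≡x+d+1 ⟨
  wt y % suc k           ≡⟨ Equivalence.to (∈Bset⇔ r y) By ⟩
  r % suc k              ≡⟨ Equivalence.to (∈Bset⇔ r x) Bx ⟨
  wt x % suc k           ∎)
  where
    open ≡-Reasoning
    y≡x+d+1 : wt y ≡ wt x + suc d
    y≡x+d+1 = trans (wt≡wt+strictCount x y (Equivalence.from T-≡ x⊑y)) (cong (wt x +_) sc≡)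

module Layers {n k : ℕ} (k≤n : k ≤ n) {A : SubsetC n} (adm : Admissible n k A)
  (meets : ∀ γ → Chain γ → length γ ≡ suc k → ∃[ x ] x ∈ᶜ γ × A x ≡ true) where

  -- A meets the chain of length k+1 through z ≺ y ≺ u; an element of A on it other than y would lie
  -- below z ≺ x or above x ≺ u, at distance at most k from x.
  diamond-closed : ∀ {x y} → Diamond x y → A x ≡ true → A y ≡ true
  diamond-closed {x} {y} (z , u , z≺x , z≺y , x≺u , y≺u) Ax
    with a , b , a+b≡k , a≤t , t+b≤n ← split-≤ k≤n (wt≤dim y)
    with v , v∈ , Av ← meets (downTo z a (y ∷ upFrom u b))
           (downTo-chain z y a (upFrom u b) z≺y (∷-upFrom-chain y u b y≺u t+b≤n)
             (subst (a ≤_) (≺⇒wt≡suc z y z≺y) a≤t))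
           (trans (length-downTo-upFrom z y u a b) (cong suc a+b≡k))
    with ∈-downTo z a (y ∷ upFrom u b) v v∈
  ... | inj₂ (v⊑z , z<v+a) = ⊥-elim (<⇒≱ (admissible-far v x adm Av Ax v⊑x v<x) x≤v+k)
    where
      wx : wt x ≡ suc (wt z)
      wx = ≺⇒wt≡suc z x z≺x
      v⊑x : v ⊑ x
      v⊑x = ⊑-trans v z x v⊑z (≺⇒⊑ z x z≺x)
      v<x : wt v < wt x
      v<x = subst (wt v <_) (sym wx) (s≤s (⊑⇒wt≤ v z v⊑z))
      x≤v+k : wt x ≤ wt v + k
      x≤v+k = ≤-trans (≤-reflexive wx) (≤-trans z<v+a (+-monoʳ-≤ (wt v) (subst (a ≤_) a+b≡k (m≤m+n a b))))
  ... | inj₁ v∈′ with ∈ᶜ-∷⁻ v y (upFrom u b) v∈′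
  ...   | inj₁ refl = Av
  ...   | inj₂ v∈up with u⊑v , v<u+b ← ∈-upFrom u b v v∈up =
    ⊥-elim (<⇒≱ (admissible-far x v adm Ax Av x⊑v x<v) v≤x+k)
    where
      wu : wt u ≡ suc (wt x)
      wu = ≺⇒wt≡suc x u x≺u
      x⊑v : x ⊑ v
      x⊑v = ⊑-trans x u v (≺⇒⊑ x u x≺u) u⊑v
      x<v : wt x < wt v
      x<v = ≤-trans (≤-reflexive (sym wu)) (⊑⇒wt≤ u v u⊑v)
      v≤x+k : wt v ≤ wt x + k
      v≤x+k = ≤-trans (≤-pred (subst (wt v <_) (cong (_+ b) wu) v<u+b))
                      (+-monoʳ-≤ (wt x) (subst (b ≤_) a+b≡k (m≤n+m b a)))

  weight-closed : ∀ x y → wt x ≡ wt y → A x ≡ true → A y ≡ true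
  weight-closed = diamond-closed⇒weight-closed (λ v → A v ≡ true) diamond-closed

  -- By weight-closed, A contains all or none of the layer L_t, which canonical n t represents.
  Layer : ℕ → Set
  Layer t = A (canonical n t) ≡ true

  Layer-≡ : ∀ {t t′} → t ≡ t′ → Layer t ⇔ Layer t′
  Layer-≡ {t} refl = ⇔-id (Layer t)

  ∈⇔Layer : ∀ x → A x ≡ true ⇔ Layer (wt x)
  ∈⇔Layer x = mk⇔ (weight-closed x c (sym wc)) (weight-closed c x wc)
    where
      c : Vec Bool n
      c = canonical n (wt x)
      wc : wt c ≡ wt x
      wc = wt-canonical (wt≤dim x)

  layers-far : ∀ {t t′} → t < t′ → t′ ≤ n → Layer t → Layer t′ → t + k < t′
  layers-far {t} {t′} t<t′ t′≤n Lt Lt′ =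
    subst₂ (λ s s′ → s + k < s′) wc wc′
      (admissible-far c c′ adm Lt Lt′ (canonical-⊑ n (<⇒≤ t<t′)) (subst₂ _<_ (sym wc) (sym wc′) t<t′))
    where
      c c′ : Vec Bool n
      c  = canonical n t
      c′ = canonical n t′
      wc : wt c ≡ t
      wc = wt-canonical (≤-trans (<⇒≤ t<t′) t′≤n)
      wc′ : wt c′ ≡ t′
      wc′ = wt-canonical t′≤n

  layer-in-window : ∀ s → s + k ≤ n → ∃[ t ] s ≤ t × t ≤ s + k × Layer t
  layer-in-window s s+k≤n =
    hit (meets (upFrom c (suc k)) (upFrom-chain c k (subst (λ w → w + k ≤ n) (sym wc) s+k≤n))
               (length-upFrom c (suc k)))
    where
      c : Vec Bool n
      c = canonical n s
      wc : wt c ≡ s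
      wc = wt-canonical (≤-trans (m≤m+n s k) s+k≤n)
      hit : ∃[ v ] v ∈ᶜ upFrom c (suc k) × A v ≡ true → ∃[ t ] s ≤ t × t ≤ s + k × Layer t
      hit (v , v∈ , Av) with c⊑v , v<c+k+1 ← ∈-upFrom c (suc k) v v∈ =
        wt v , subst (_≤ wt v) wc (⊑⇒wt≤ c v c⊑v) ,
        ≤-pred (subst (wt v <_) (trans (cong (_+ suc k) wc) (+-suc s k)) v<c+k+1) ,
        Equivalence.to (∈⇔Layer v) Av

  Layer-step : ∀ t → t + suc k ≤ n → Layer t ⇔ Layer (t + suc k)
  Layer-step t le = mk⇔ up down
    where
      le′ : suc (t + k) ≤ n
      le′ = subst (_≤ n) (+-suc t k) le
      up : Layer t → Layer (t + suc k)
      up Lt with t′ , t<t′ , t′≤ , Lt′ ← layer-in-window (suc t) le′ =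
        subst Layer (trans (≤-antisym t′≤ (layers-far t<t′ (≤-trans t′≤ le′) Lt Lt′)) (sym (+-suc t k)))
              Lt′
      down : Layer (t + suc k) → Layer t
      down Lt+k+1 with t′ , t≤t′ , t′≤ , Lt′ ← layer-in-window t (≤-trans (n≤1+n _) le′) =
        subst Layer (≤-antisym (+-cancelʳ-≤ k t′ t (≤-pred (subst (t′ + k <_) (+-suc t k) far))) t≤t′) Lt′
        where
          far : t′ + k < t + suc k
          far = layers-far (subst (t′ <_) (sym (+-suc t k)) (s≤s t′≤)) le Lt′ Lt+k+1

  Layer-shift : ∀ q t → t + q * suc k ≤ n → Layer t ⇔ Layer (t + q * suc k)
  Layer-shift zero    t _  = Layer-≡ (sym (+-identityʳ t))
  Layer-shift (suc q) t le =
    Layer-≡ (sym shift) ⇔-∘ (Layer-step (t + q * suc k) (subst (_≤ n) shift le) ⇔-∘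
                             Layer-shift q t (≤-trans (m≤m+n _ (suc k)) (subst (_≤ n) shift le)))
    where
      shift : t + suc q * suc k ≡ t + q * suc k + suc k
      shift = trans (cong (t +_) (+-comm (suc k) (q * suc k))) (sym (+-assoc t (q * suc k) (suc k)))

  Layer-mod : ∀ t → t ≤ n → Layer t ⇔ Layer (t % suc k)
  Layer-mod t t≤n =
    ⇔-sym (Layer-≡ (sym t≡) ⇔-∘ Layer-shift (t / suc k) (t % suc k) (subst (_≤ n) t≡ t≤n))
    where
      t≡ : t ≡ t % suc k + t / suc k * suc k
      t≡ = m≡m%n+[m/n]*n t (suc k)

  Layer-unique≤k : ∀ {s t} → s ≤ k → t ≤ k → Layer s → Layer t → s ≡ t
  Layer-unique≤k {s} {t} s≤k t≤k Ls Lt with <-cmp s t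
  ... | tri< s<t _ _ = ⊥-elim (<⇒≱ (layers-far s<t (≤-trans t≤k k≤n) Ls Lt) (≤-trans t≤k (m≤n+m k s)))
  ... | tri≈ _ s≡t _ = s≡t
  ... | tri> _ _ t<s = ⊥-elim (<⇒≱ (layers-far t<s (≤-trans s≤k k≤n) Lt Ls) (≤-trans s≤k (m≤n+m k t)))

  Layer⇔≡-mod : ∀ {r} → r ≤ n → Layer r → ∀ t → t ≤ n → Layer t ⇔ (t % suc k ≡ r % suc k)
  Layer⇔≡-mod {r} r≤n Lr t t≤n =
    mk⇔ (λ Lρ → Layer-unique≤k (res t) (res r) Lρ Lρ′) (λ e → subst Layer (sym e) Lρ′) ⇔-∘ Layer-mod t t≤n
    where
      res : ∀ m → m % suc k ≤ k
      res m = ≤-pred (m%n<n m (suc k))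
      Lρ′ : Layer (r % suc k)
      Lρ′ = Equivalence.to (Layer-mod r r≤n) Lr

  residue-class : ∀ {x} → A x ≡ true → A ≐ Bset n k (wt x)
  residue-class {x} Ax y = true⇔true⇒≡
    (⇔-sym (∈Bset⇔ (wt x) y) ⇔-∘
      (Layer⇔≡-mod (wt≤dim x) (Equivalence.to (∈⇔Layer x) Ax) (wt y) (wt≤dim y) ⇔-∘ ∈⇔Layer y))

n≡1+h+h⇒h<n : ∀ {n h} → n ≡ suc (h + h) → h < n
n≡1+h+h⇒h<n {h = h} n≡2h+1 = subst (h <_) (sym n≡2h+1) (s≤s (m≤m+n h h))

middle-chain-even : ∀ {n k h} → n ≡ h + h → canonical n h ∷ [] ∈ chainsC n k
middle-chain-even {n} {k} {h} n≡2h = symmetric⇒∈chainsC _ tt (s≤s z≤n)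
  (Equivalence.from (symmetric⇔ (canonical n h) [])
    (trans (cong (λ w → w + (w + 0)) (wt-canonical (subst (h ≤_) (sym n≡2h) (m≤m+n h h))))
           (trans (cong (h +_) (+-identityʳ h)) (sym n≡2h))))

middle-chain-odd : ∀ {n k h} → 1 ≤ k → n ≡ suc (h + h) →
  canonical n h ∷ canonical n (suc h) ∷ [] ∈ chainsC n k
middle-chain-odd {n} {k} {h} 1≤k n≡2h+1 = symmetric⇒∈chainsC _
  (chain-∷ (canonical n h) (canonical n (suc h)) [] (canonical-≺ (n≡1+h+h⇒h<n n≡2h+1)) tt) (s≤s 1≤k)
  (Equivalence.from (symmetric⇔ (canonical n h) (canonical n (suc h) ∷ []))
    (trans (cong (λ w → w + (w + 1)) (wt-canonical (<⇒≤ (n≡1+h+h⇒h<n n≡2h+1))))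
           (trans (cong (h +_) (+-comm h 1)) (trans (+-suc h h) (sym n≡2h+1)))))

module Maximum {n k : ℕ} (1≤k : 1 ≤ k) (k≤n : k ≤ n) (w : List (Vec Bool n) → ℚ)
  (w-pos : ∀ γ → γ ∈ chainsC n k → 0ℚ ℚ.< w γ)
  (w-partition : ∀ x → sumℚ (map w (filterᵇ (memᵇ x) (chainsC n k))) ≡ 1ℚ) where

  open DoubleCounting (allVecs n) (chainsC n k) memᵇ w (w-pos _) w-partition

  admissible⇒hits≤1 : ∀ {A γ} → Admissible n k A → γ ∈ chainsC n k → hits A γ ≤ 1
  admissible⇒hits≤1 {A} {γ} adm γ∈ with ch , len ← ∈chainsC⇒chain γ γ∈ =
    hits≤1 {A} {γ} (allVecs-unique n) (λ {x} {y} → admissible-chain-≡ γ x y adm ch len)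

  central⇒Bset-meets : ∀ r → Central n r → ∀ γ → γ ∈ chainsC n k →
    ∃[ x ] x ∈ᶜ γ × Bset n k r x ≡ true
  central⇒Bset-meets r central []      γ∈ = ⊥-elim (proj₁ (∈chainsC⁻ [] γ∈))
  central⇒Bset-meets r central (a ∷ γ) γ∈ with ∈chainsC⁻ (a ∷ γ) γ∈
  ... | ch , inj₁ len
    with t , a≤t , t≤a+k , t≡r ← ∃-window-≡-mod (wt a) r k
    with x , x∈ , wx≡t ← chain-hits-weight a γ ch a≤t
                           (subst (λ l → t ≤ wt a + l) (sym (suc-injective len)) t≤a+k)
    = x , x∈ , Equivalence.from (∈Bset⇔ r x) (trans (cong (_% suc k) wx≡t) t≡r)
  ... | ch , inj₂ (_ , symmetric)
    with a≤r , r≤a+l ← central⇒between {r = r} central (Equivalence.to (symmetric⇔ a γ) symmetric)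
    with x , x∈ , wx≡r ← chain-hits-weight a γ ch a≤r r≤a+l
    = x , x∈ , Equivalence.from (∈Bset⇔ r x) (cong (_% suc k) wx≡r)

  central⇒size-Bset : ∀ r → Central n r → fromℕ (card (Bset n k r)) ≡ total
  central⇒size-Bset r central = size≡total λ {γ} γ∈ →
    let (x , x∈ , Bx) = central⇒Bset-meets r central γ γ∈
    in ≤-antisym (admissible⇒hits≤1 (Bset-admissible n k r) γ∈)
                 (hits≥1 {Bset n k r} {γ} (∈-allVecs x) x∈ Bx)

  central⇒Bset-max : ∀ r → Central n r → IsMaxAdmissible n k (Bset n k r)
  central⇒Bset-max r central = Bset-admissible n k r , λ A adm →
    fromℕ-cancel-≤ (subst (fromℕ (card A) ℚ.≤_) (sym (central⇒size-Bset r central))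
                          (size≤total (admissible⇒hits≤1 adm)))

  max⇒meets : ∀ {A} → IsMaxAdmissible n k A → ∀ γ → γ ∈ chainsC n k → ∃[ x ] x ∈ᶜ γ × A x ≡ true
  max⇒meets {A} (adm , max) γ γ∈ = hits≢0⇒∃ {A} {γ} λ hits≡0 →
    ℚ.<-irrefl refl (ℚ.<-≤-trans (size<total (admissible⇒hits≤1 adm) γ∈ hits≡0) total≤size)
    where
      total≤size : total ℚ.≤ fromℕ (card A)
      total≤size = subst (ℚ._≤ fromℕ (card A)) (central⇒size-Bset (n / 2) (central-⌊n/2⌋ n))
                     (fromℕ-mono-≤ (max _ (Bset-admissible n k (n / 2))))

  max⇒residue-class : ∀ {A} → IsMaxAdmissible n k A → ∀ γ → γ ∈ chainsC n k →
    ∃[ x ] x ∈ᶜ γ × A ≐ Bset n k (wt x)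
  max⇒residue-class A-max@(adm , _) γ γ∈ with x , x∈ , Ax ← max⇒meets A-max γ γ∈ =
    x , x∈ , Layers.residue-class k≤n adm (λ γ ch len → max⇒meets A-max γ (chain⇒∈chainsC γ ch len)) Ax

  even-unique : ∀ {A} h → n ≡ h + h → IsMaxAdmissible n k A → A ≐ Bset n k h
  even-unique {A} h n≡2h A-max =
    through (max⇒residue-class A-max (canonical n h ∷ []) (middle-chain-even n≡2h))
    where
      through : ∃[ x ] x ∈ᶜ (canonical n h ∷ []) × A ≐ Bset n k (wt x) → A ≐ Bset n k h
      through (x , x∈ , A≐) with ∈ᶜ-∷⁻ x (canonical n h) [] x∈
      ... | inj₁ refl = subst (λ r → A ≐ Bset n k r) (wt-canonical (subst (h ≤_) (sym n≡2h) (m≤m+n h h))) A≐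

  odd-unique : ∀ {A} h → n ≡ suc (h + h) → IsMaxAdmissible n k A → A ≐ Bset n k h ⊎ A ≐ Bset n k (suc h)
  odd-unique {A} h n≡2h+1 A-max =
    through (max⇒residue-class A-max (canonical n h ∷ canonical n (suc h) ∷ []) (middle-chain-odd 1≤k n≡2h+1))
    where
      through : ∃[ x ] x ∈ᶜ (canonical n h ∷ canonical n (suc h) ∷ []) × A ≐ Bset n k (wt x) →
        A ≐ Bset n k h ⊎ A ≐ Bset n k (suc h)
      through (x , x∈ , A≐) with ∈ᶜ-∷⁻ x (canonical n h) (canonical n (suc h) ∷ []) x∈
      ... | inj₁ refl =
        inj₁ (subst (λ r → A ≐ Bset n k r) (wt-canonical (<⇒≤ (n≡1+h+h⇒h<n n≡2h+1))) A≐)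
      ... | inj₂ x∈′ with ∈ᶜ-∷⁻ x (canonical n (suc h)) [] x∈′
      ...   | inj₁ refl = inj₂ (subst (λ r → A ≐ Bset n k r) (wt-canonical (n≡1+h+h⇒h<n n≡2h+1)) A≐)

lemma3p4 : (n k : ℕ) → 1 ≤ n → 1 ≤ k → k ≤ n →
    (∃[ w ] ((∀ (γ : List (Vec Bool n)) → γ ∈ chainsC n k → 0ℚ ℚ.< w γ)
      × (∀ (x : Vec Bool n) → sumℚ (map w (filterᵇ (memᵇ x) (chainsC n k))) ≡ 1ℚ))) →
    ((n % 2 ≡ 0 →
        IsMaxAdmissible n k (Bset n k (n / 2))
        × (∀ A → IsMaxAdmissible n k A → A ≐ Bset n k (n / 2)))
    × (n % 2 ≡ 1 →
        IsMaxAdmissible n k (Bset n k (n / 2))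
        × IsMaxAdmissible n k (Bset n k ((n + 1) / 2))
        × (∀ A → IsMaxAdmissible n k A → (A ≐ Bset n k (n / 2)) ⊎ (A ≐ Bset n k ((n + 1) / 2)))))
lemma3p4 n k _ 1≤k k≤n (w , w-pos , w-partition) = even , odd
  where
    open Maximum 1≤k k≤n w w-pos w-partition
    even : n % 2 ≡ 0 →
      IsMaxAdmissible n k (Bset n k (n / 2)) × (∀ A → IsMaxAdmissible n k A → A ≐ Bset n k (n / 2))
    even n%2≡0 =
      central⇒Bset-max (n / 2) (central-⌊n/2⌋ n) ,
      λ A → even-unique (n / 2) (n%2≡0⇒n≡h+h n%2≡0)
    odd : n % 2 ≡ 1 →
      IsMaxAdmissible n k (Bset n k (n / 2)) × IsMaxAdmissible n k (Bset n k ((n + 1) / 2)) ×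
      (∀ A → IsMaxAdmissible n k A → A ≐ Bset n k (n / 2) ⊎ A ≐ Bset n k ((n + 1) / 2))
    odd n%2≡1 =
      central⇒Bset-max (n / 2) (central-⌊n/2⌋ n) ,
      subst (IsMaxAdmissible n k ∘ Bset n k) (sym ⌈n/2⌉≡)
            (central⇒Bset-max (suc (n / 2)) (central-⌈n/2⌉ n≡2h+1)) ,
      λ A → Sum.map₂ (subst (λ r → A ≐ Bset n k r) (sym ⌈n/2⌉≡)) ∘ odd-unique (n / 2) n≡2h+1
      where
        n≡2h+1 : n ≡ suc (n / 2 + n / 2)
        n≡2h+1 = n%2≡1⇒n≡1+h+h n%2≡1
        ⌈n/2⌉≡ : (n + 1) / 2 ≡ suc (n / 2)
        ⌈n/2⌉≡ = n≡1+h+h⇒[n+1]/2≡1+h n≡2h+1
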